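{- Let $\Omega$ be a countably infinite set, $E=\mathrm{Self}(\Omega)$, and $M\subseteq E$ a submonoid that is closed in the function topology and has dense fm-to-one maps. If $M_{(\Sigma)}$ has an infinite forward orbit for every finite $\Sigma\subseteq\Omega$, then $M\approx E$.
   Context: $\mathrm{Self}(\Omega)$ is the monoid of maps $\Omega\to\Omega$, written on the right. The function topology has subbasis $\{f:(\alpha)f=\beta\}$. A map is fm-to-one if the preimage of every element is finite; $M$ has dense fm-to-one maps if its fm-to-one elements are dense in $M$ in the function topology. $U_{(\Sigma)}=\{f\in U:(\alpha)f=\alpha\ \forall\alpha\in\Sigma\}$; the forward orbit of $\alpha$ under $U$ is $(\alpha)U=\{(\alpha)f:f\in U\}$. $M_1\approx M_2$ means there exist finite $U,V\subseteq E$ with $M_1\subseteq\langle M_2\cup U\rangle$ and $M_2\subseteq\langle M_1\cup V\rangle$, $\langle X\rangle$ the generated submonoid. -}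

module Defs where

open import Data.Nat using (ℕ; _<_; _≥_)
open import Data.List using (List)
open import Data.List.Membership.Propositional using (_∈_)
open import Data.Product using (Σ; ∃; _×_)
open import Data.Sum using (_⊎_)
open import Relation.Binary.PropositionalEquality using (_≡_)

-- Ω is the countably infinite set ℕ; E = Self(Ω) = ℕ → ℕ.
Self : Set
Self = ℕ → ℕ

Pred : Set₁
Pred = Self → Set

-- Maps act on the right: (α)(f ; g) = ((α)f)g.
_⨾_ : Self → Self → Self
(f ⨾ g) α = g (f α)

idS : Self
idS α = α

IsSubmonoid : Pred → Set
IsSubmonoid M = M idS × (∀ f g → M f → M g → M (f ⨾ g))

AgreeOn : List ℕ → Self → Self → Set
AgreeOn Σ' f g = ∀ α → α ∈ Σ' → f α ≡ g α

-- Closed in the function topology: every f in the closure of M lies in M,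
-- where f is in the closure iff every basic neighbourhood (fixing finitely many values of f)
-- meets M.
IsClosed : Pred → Set
IsClosed M = ∀ f → (∀ (Σ' : List ℕ) → ∃ λ g → M g × AgreeOn Σ' f g) → M f

-- fm-to-one: every preimage (α)f = β is finite, i.e. bounded in ℕ.
FmToOne : Self → Set
FmToOne f = ∀ β → ∃ λ N → ∀ α → f α ≡ β → α < N

DenseFmToOne : Pred → Set
DenseFmToOne M = ∀ f → M f → ∀ (Σ' : List ℕ) → ∃ λ g → M g × FmToOne g × AgreeOn Σ' f g

Stab : Pred → List ℕ → Pred
Stab M Σ' f = M f × (∀ α → α ∈ Σ' → f α ≡ α)

-- The forward orbit (α)U is infinite (as a subset of ℕ: unbounded).
InfiniteOrbit : Pred → ℕ → Set
InfiniteOrbit U α = ∀ N → ∃ λ f → U f × f α ≥ N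

HasInfiniteOrbit : Pred → Set
HasInfiniteOrbit U = ∃ λ α → InfiniteOrbit U α

_∪L_ : Pred → List Self → Pred
(X ∪L U) f = X f ⊎ f ∈ U

-- Generated submonoid ⟨X⟩ (up to pointwise equality of maps, since no funext).
data ⟨_⟩ (X : Pred) : Pred where
  gen-id   : ⟨ X ⟩ idS
  gen-mem  : ∀ {f} → X f → ⟨ X ⟩ f
  gen-comp : ∀ {f g} → ⟨ X ⟩ f → ⟨ X ⟩ g → ⟨ X ⟩ (f ⨾ g)
  gen-ext  : ∀ {f g} → ⟨ X ⟩ f → (∀ α → f α ≡ g α) → ⟨ X ⟩ g

_⊆_ : Pred → Pred → Set
A ⊆ B = ∀ f → A f → B f

E : Pred
E _ = Data.Unit.⊤
  where import Data.Unit

_≈_ : Pred → Pred → Set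
M₁ ≈ M₂ = ∃ λ (U : List Self) → ∃ λ (V : List Self) →
  (M₁ ⊆ ⟨ M₂ ∪L U ⟩) × (M₂ ⊆ ⟨ M₁ ∪L V ⟩)

module Submission where

-- Choose levels L₀ < L₁ < … and points αₙ < Lₙ₊₁ such that αₙ has an infinite
-- orbit under the stabiliser of [0, Lₙ). For every sequence of thresholds, composing
-- fm-to-one elements of M that fix [0, Lₙ) yields maps in M that stabilise pointwise,
-- so their limit p lies in M by closedness; since fm-to-one maps tend to infinity,
-- p(αₙ) can be pushed above the n-th threshold. Enumerating all finite histories of
-- thresholds, each threshold is chosen so that the value reached lies in an interval
-- reserved for the pair (h(n), history). One decoding map z, independent of h, then
-- reads off h(n) from p(αₙ), so every h equals α ⨾ p ⨾ z.

open import Defs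
open import Data.Nat using (ℕ; zero; suc; _+_; _≤_; _<_; _≤′_; ≤′-refl; ≤′-step; _⊔_; z≤n; s≤s; _≤?_)
open import Data.Nat.Properties
open import Data.List using (List; []; _∷_; length; upTo)
open import Data.List.Extrema.Nat using (max; xs≤max)
open import Data.List.Relation.Unary.All as All using ()
open import Data.List.Relation.Unary.Any using (here; there)
open import Data.List.Membership.Propositional using (_∈_)
open import Data.List.Membership.Propositional.Properties using (∈-upTo⁺)
open import Data.Product using (∃; _×_; _,_; proj₁; proj₂)
open import Data.Sum using (inj₁; inj₂)
open import Data.Unit using (tt)
open import Relation.Nullary using (yes; no)
open import Relation.Nullary.Negation using (contradiction)
open import Relation.Binary.PropositionalEquality using (_≡_; refl; sym; trans; cong; subst)

triangle : ℕ → ℕ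
triangle zero    = 0
triangle (suc s) = suc s + triangle s

pair : ℕ → ℕ → ℕ
pair a b = a + triangle (a + b)

cantorSucc : ℕ × ℕ → ℕ × ℕ
cantorSucc (a , zero)  = 0 , suc a
cantorSucc (a , suc b) = suc a , b

unpair : ℕ → ℕ × ℕ
unpair zero    = 0 , 0
unpair (suc n) = cantorSucc (unpair n)

unpair-diagonal : ∀ s a b → a + b ≡ s → unpair (a + triangle s) ≡ (a , b)
unpair-diagonal zero    zero    zero     refl = refl
unpair-diagonal (suc s) zero    .(suc s) refl =
  cong cantorSucc (unpair-diagonal s s 0 (+-identityʳ s))
unpair-diagonal s       (suc a) b        eq   =
  cong cantorSucc (unpair-diagonal s a (suc b) (trans (+-suc a b) eq))

unpair-pair : ∀ a b → unpair (pair a b) ≡ (a , b)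
unpair-pair a b = unpair-diagonal (a + b) a b refl

n≤triangle : ∀ n → n ≤ triangle n
n≤triangle zero    = z≤n
n≤triangle (suc n) = m≤m+n (suc n) (triangle n)

n≤pair : ∀ m n → n ≤ pair m n
n≤pair m n = begin
  n                      ≤⟨ m≤n+m n m ⟩
  m + n                  ≤⟨ n≤triangle (m + n) ⟩
  triangle (m + n)       ≤⟨ m≤n+m _ m ⟩
  m + triangle (m + n)   ∎
  where open ≤-Reasoning

encode : List ℕ → ℕ
encode []       = 0
encode (a ∷ as) = suc (pair a (encode as))

-- A code exceeds the code of its tail, so fuel equal to the code itself suffices.
decodeWithin : ℕ → ℕ → List ℕ
decodeWithin _        zero    = []
decodeWithin zero     (suc n) = []
decodeWithin (suc k) (suc n)  = proj₁ (unpair n) ∷ decodeWithin k (proj₂ (unpair n))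

decode : ℕ → List ℕ
decode n = decodeWithin n n

decodeWithin-encode : ∀ as k → encode as ≤ k → decodeWithin k (encode as) ≡ as
decodeWithin-encode []       k       _         = refl
decodeWithin-encode (a ∷ as) (suc k) (s≤s ≤k) rewrite unpair-pair a (encode as) =
  cong (a ∷_) (decodeWithin-encode as k (≤-trans (n≤pair a (encode as)) ≤k))

decode-encode : ∀ as → decode (encode as) ≡ as
decode-encode as = decodeWithin-encode as (encode as) ≤-refl

FmToOne⇒eventually≥ : ∀ {f} → FmToOne f → ∀ K → ∃ λ N → ∀ y → N ≤ y → K ≤ f y
FmToOne⇒eventually≥ f-fm zero = 0 , λ _ _ → z≤n
FmToOne⇒eventually≥ f-fm (suc K)
  with FmToOne⇒eventually≥ f-fm K | f-fm K
... | N , ≥K | B , below =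
  N ⊔ B , λ y N⊔B≤y → ≤∧≢⇒< (≥K y (≤-trans (m≤m⊔n N B) N⊔B≤y))
                              (λ K≡fy → <⇒≱ (below y (sym K≡fy)) (≤-trans (m≤n⊔m N B) N⊔B≤y))

eventually≥⇒FmToOne : ∀ {f} → (∀ K → ∃ λ N → ∀ y → N ≤ y → K ≤ f y) → FmToOne f
eventually≥⇒FmToOne eventually β with eventually (suc β)
... | N , ≥β+1 = N , λ y fy≡β → ≰⇒> λ N≤y → <-irrefl (sym fy≡β) (≥β+1 y N≤y)

FmToOne-id : FmToOne idS
FmToOne-id = eventually≥⇒FmToOne λ K → K , λ _ K≤y → K≤y

FmToOne-⨾ : ∀ {f g} → FmToOne f → FmToOne g → FmToOne (f ⨾ g)
FmToOne-⨾ f-fm g-fm = eventually≥⇒FmToOne λ K →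
  let N , ≥K = FmToOne⇒eventually≥ g-fm K
      N′ , ≥N = FmToOne⇒eventually≥ f-fm N
  in N′ , λ y N′≤y → ≥K _ (≥N y N′≤y)

module Increasing {t : ℕ → ℕ} (t-incr : ∀ n → t n < t (suc n)) where

  mono-≤′ : ∀ {m n} → m ≤′ n → t m ≤ t n
  mono-≤′ ≤′-refl        = ≤-refl
  mono-≤′ (≤′-step m≤′n) = ≤-trans (mono-≤′ m≤′n) (<⇒≤ (t-incr _))

  mono : ∀ {m n} → m ≤ n → t m ≤ t n
  mono m≤n = mono-≤′ (≤⇒≤′ m≤n)

  n≤t : ∀ n → n ≤ t n
  n≤t zero    = z≤n
  n≤t (suc n) = ≤-trans (s≤s (n≤t n)) (t-incr n)

  -- The largest j ≤ bound with t j ≤ v (0 if there is none).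
  indexBelow : ℕ → ℕ → ℕ
  indexBelow v zero = 0
  indexBelow v (suc j) with t (suc j) ≤? v
  ... | yes _ = suc j
  ... | no  _ = indexBelow v j

  indexBelow-unique : ∀ {v j} bound → j ≤ bound → t j ≤ v → v < t (suc j) →
                      indexBelow v bound ≡ j
  indexBelow-unique zero    z≤n _ _ = refl
  indexBelow-unique {v} (suc b) j≤1+b tj≤v v<tj+1
    with m≤n⇒m<n∨m≡n j≤1+b | t (suc b) ≤? v
  ... | inj₂ refl       | yes _    = refl
  ... | inj₂ refl       | no  tj≰v = contradiction tj≤v tj≰v
  ... | inj₁ (s≤s j≤b) | yes tb≤v = contradiction (≤-trans v<tj+1 (mono (s≤s j≤b))) (≤⇒≯ tb≤v)
  ... | inj₁ (s≤s j≤b) | no  _    = indexBelow-unique b j≤b tj≤v v<tj+1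

  index : ℕ → ℕ
  index v = indexBelow v v

  index-unique : ∀ {v j} → t j ≤ v → v < t (suc j) → index v ≡ j
  index-unique {v} {j} tj≤v = indexBelow-unique v (≤-trans (n≤t j) tj≤v) tj≤v

module Stabilising (P : ℕ → Self) {L : ℕ → ℕ} (L-incr : ∀ n → L n < L (suc n))
                   (stable : ∀ n x → x < L n → P (suc n) x ≡ P n x) where

  open Increasing L-incr using (mono; n≤t)

  stable-≤′ : ∀ {m n} x → x < L m → m ≤′ n → P n x ≡ P m x
  stable-≤′ x x<Lm ≤′-refl        = refl
  stable-≤′ x x<Lm (≤′-step m≤′n) =
    trans (stable _ x (≤-trans x<Lm (mono (≤′⇒≤ m≤′n)))) (stable-≤′ x x<Lm m≤′n)

  lim : Self
  lim x = P (suc x) x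

  lim-agrees : ∀ n x → x < L n → lim x ≡ P n x
  lim-agrees n x x<Ln with ≤-total (suc x) n
  ... | inj₁ 1+x≤n = sym (stable-≤′ x (n≤t (suc x)) (≤⇒≤′ 1+x≤n))
  ... | inj₂ n≤1+x = stable-≤′ x x<Ln (≤⇒≤′ n≤1+x)

  lim-∈ : ∀ {M} → IsClosed M → (∀ n → M (P n)) → M lim
  lim-∈ closed P∈M = closed lim λ Σ′ →
    let N = suc (max 0 Σ′) in
    P N , P∈M N , λ x x∈Σ′ →
      lim-agrees N x (≤-trans (s≤s (All.lookup (xs≤max 0 Σ′) x∈Σ′)) (n≤t N))

push-orbit : ∀ {M} → DenseFmToOne M → ∀ Σ′ {α} → InfiniteOrbit (Stab M Σ′) α →
             ∀ {f} → FmToOne f → ∀ K →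
             ∃ λ g → Stab M Σ′ g × FmToOne g × K ≤ f (g α)
push-orbit dense Σ′ {α} orbit f-fm K with FmToOne⇒eventually≥ f-fm K
... | N , ≥K with orbit N
... | g₀ , (g₀∈M , g₀-fixes) , N≤g₀α with dense g₀ g₀∈M (α ∷ Σ′)
... | g , g∈M , g-fm , g≈g₀ =
  g , (g∈M , fixes) , g-fm , ≥K (g α) (subst (N ≤_) (g≈g₀ α (here refl)) N≤g₀α)
  where
    fixes : ∀ a → a ∈ Σ′ → g a ≡ a
    fixes a a∈Σ′ = trans (sym (g≈g₀ a (there a∈Σ′))) (g₀-fixes a a∈Σ′)

record FmMember (M : Pred) : Set where
  field
    map  : Self
    ∈M   : M map
    fm   : FmToOne map
open FmMember

module Construction (M : Pred) (submonoid : IsSubmonoid M) (dense : DenseFmToOne M)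
                    (orbits : ∀ Σ′ → HasInfiniteOrbit (Stab M Σ′)) where

  level : ℕ → ℕ
  level zero    = 0
  level (suc n) = suc (proj₁ (orbits (upTo (level n)))) + level n

  point : ℕ → ℕ
  point n = proj₁ (orbits (upTo (level n)))

  level-incr : ∀ n → level n < level (suc n)
  level-incr n = s≤s (m≤n+m (level n) (point n))

  point<level : ∀ n → point n < level (suc n)
  point<level n = s≤s (m≤m+n (point n) (level n))

  push : ∀ n {f} → FmToOne f → ∀ K →
         ∃ λ g → Stab M (upTo (level n)) g × FmToOne g × K ≤ f (g (point n))
  push n = push-orbit dense (upTo (level n)) (proj₂ (orbits (upTo (level n))))

  identity : FmMember M
  identity = record { map = idS ; ∈M = proj₁ submonoid ; fm = FmToOne-id }

  extend : ℕ → ℕ → FmMember M → FmMember M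
  extend n K s =
    let g , (g∈M , _) , g-fm , _ = push n (fm s) K in
    record { map = g ⨾ map s
           ; ∈M  = proj₂ submonoid g (map s) g∈M (∈M s)
           ; fm  = FmToOne-⨾ g-fm (fm s)
           }

  extend-fixes : ∀ n K s x → x < level n → map (extend n K s) x ≡ map s x
  extend-fixes n K s x x<level =
    let _ , (_ , g-fixes) , _ = push n (fm s) K in
    cong (map s) (g-fixes x (∈-upTo⁺ x<level))

  extend-large : ∀ n K s → K ≤ map (extend n K s) (point n)
  extend-large n K s = let _ , _ , _ , large = push n (fm s) K in large

  -- The thresholds are listed most recent first.
  stage : List ℕ → FmMember M
  stage []       = identity
  stage (K ∷ Ks) = extend (length Ks) K (stage Ks)

  value : List ℕ → ℕ → ℕ
  value Ks K = map (stage (K ∷ Ks)) (point (length Ks))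

  -- Each j codes a pair (k, history); its reserved interval is [threshold j, threshold (suc j)).
  threshold : ℕ → ℕ
  valueAt : ℕ → ℕ

  threshold zero    = 0
  threshold (suc j) = suc (valueAt j)

  valueAt j = value (decode (proj₂ (unpair j))) (threshold j)

  threshold≤valueAt : ∀ j → threshold j ≤ valueAt j
  threshold≤valueAt j = extend-large (length Ks) (threshold j) (stage Ks)
    where Ks = decode (proj₂ (unpair j))

  threshold-incr : ∀ j → threshold j < threshold (suc j)
  threshold-incr j = s≤s (threshold≤valueAt j)

  open Increasing threshold-incr using (index; index-unique)

  decoder : Self
  decoder v = proj₁ (unpair (index v))

  decoder-value : ∀ k Ks → decoder (value Ks (threshold (pair k (encode Ks)))) ≡ k
  decoder-value k Ks = begin
    decoder (value Ks (threshold j))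
      ≡⟨ cong (λ ks → decoder (value ks (threshold j))) (sym decode≡Ks) ⟩
    decoder (valueAt j)
      ≡⟨ cong (λ i → proj₁ (unpair i)) (index-unique (threshold≤valueAt j) ≤-refl) ⟩
    proj₁ (unpair j)
      ≡⟨ cong proj₁ (unpair-pair k (encode Ks)) ⟩
    k ∎
    where
      open Relation.Binary.PropositionalEquality.≡-Reasoning
      j = pair k (encode Ks)
      decode≡Ks : decode (proj₂ (unpair j)) ≡ Ks
      decode≡Ks = trans (cong (λ c → decode (proj₂ c)) (unpair-pair k (encode Ks)))
                        (decode-encode Ks)

  module Realise (h : Self) where

    history : ℕ → List ℕ
    nextThreshold : ℕ → ℕ

    history zero    = []
    history (suc n) = nextThreshold n ∷ history n

    nextThreshold n = threshold (pair (h n) (encode (history n)))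

    length-history : ∀ n → length (history n) ≡ n
    length-history zero    = refl
    length-history (suc n) = cong suc (length-history n)

    approx : ℕ → Self
    approx n = map (stage (history n))

    approx-stable : ∀ n x → x < level n → approx (suc n) x ≡ approx n x
    approx-stable n x x<level =
      extend-fixes (length (history n)) (nextThreshold n) (stage (history n)) x
        (subst (λ m → x < level m) (sym (length-history n)) x<level)

    open Stabilising approx level-incr approx-stable using (lim; lim-agrees; lim-∈)

    lim∈M : IsClosed M → M lim
    lim∈M closed = lim-∈ closed (λ n → ∈M (stage (history n)))

    realises : ∀ n → decoder (lim (point n)) ≡ h n
    realises n = trans (cong decoder lim≡value) (decoder-value (h n) (history n))
      where
        lim≡value : lim (point n) ≡ value (history n) (nextThreshold n)
        lim≡value = trans (lim-agrees (suc n) (point n) (point<level n))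
          (cong (λ m → approx (suc n) (point m)) (sym (length-history n)))

proposition32 : (M : Pred) → IsSubmonoid M → IsClosed M → DenseFmToOne M →
    (∀ (Σ' : List ℕ) → HasInfiniteOrbit (Stab M Σ')) →
    M ≈ E
proposition32 M submonoid closed dense orbits =
  [] , point ∷ decoder ∷ [] , (λ _ _ → gen-mem (inj₁ tt)) , λ h _ →
    let open Realise h in
    gen-ext (gen-comp (gen-comp (gen-mem (inj₂ (here refl))) (gen-mem (inj₁ (lim∈M closed))))
                      (gen-mem (inj₂ (there (here refl)))))
            realises
  where open Construction M submonoid dense orbits
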